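{- Let $n\ge1$. If $\{H_1,H_2\}$ is a Hamilton decomposition of $G_{n,2}$ and $\{E_1,\dots,E_n\}$ is a Hamilton decomposition of $Q_{2n}$, then $\{f(E_i,H_j): 1\le i\le n,\ 1\le j\le 2\}$ is a Hamilton decomposition of $Q_{4n}$.
   Context: $G_{n,2}=C_{4^n}\Box C_{4^n}$: vertices $(x,y)$ with $x,y\in\mathbb{Z}/4^n\mathbb{Z}$, adjacent iff they differ in one coordinate by $\pm1$. $Q_{2m}$ is identified with $C_4\Box\cdots\Box C_4$ ($m$ factors): quaternary strings of length $m$, adjacent iff differing in one position by $\pm1\pmod4$. A Hamilton decomposition of a graph is a set of (directed) Hamilton cycles whose edge sets partition the edge set; directed Hamilton cycles start at the origin. Definition of $f$: for a directed Hamilton cycle $E$ of $Q_{2n}$, let $\varphi_E(u)=t$ if $u$ is the $t$-th vertex of $E$ (origin is the $0$-th). Identify $Q_{4n}=Q_{2n}\Box Q_{2n}$, a vertex $(u,v)$ having $u$ on axes $1,\dots,n$ and $v$ on axes $n+1,\dots,2n$. The map $(u,v)\mapsto(\varphi_E(u),\varphi_E(v))$ is a bijection onto $V(G_{n,2})$ fixing the origin, under which every edge of $G_{n,2}$ pulls back to an edge of $Q_{4n}$; for a directed Hamilton cycle $H$ of $G_{n,2}$, $f(E,H)$ is the Hamilton cycle of $Q_{4n}$ that is the preimage of $H$. -}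

module Defs where

open import Data.Nat using (ℕ; zero; suc; _^_; _*_; _+_; _≤_)
open import Data.Nat.DivMod using (_%_; m%n<n)
open import Data.Nat.Properties using (m^n>0)
open import Data.Fin using (Fin; toℕ; fromℕ<)
open import Data.Vec using (Vec; lookup; replicate; _++_)
open import Data.Product using (Σ; ∃; _×_; _,_; proj₁; proj₂)
open import Data.Sum using (_⊎_)
open import Relation.Binary.PropositionalEquality using (_≡_; _≢_)
open import Function.Definitions using (Bijective)

csucc : ∀ {N} → Fin N → Fin N
csucc {suc k} i = fromℕ< (m%n<n (suc (toℕ i)) (suc k))

CycAdj : ∀ {N} → Fin N → Fin N → Set
CycAdj x y = (y ≡ csucc x) ⊎ (x ≡ csucc y)

IsDirHamCycle : ∀ {V : Set} (Adj : V → V → Set) (o : V) (N : ℕ) → (Fin N → V) → Set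
IsDirHamCycle Adj o N c =
  Bijective _≡_ _≡_ c
  × (∀ t → toℕ t ≡ 0 → c t ≡ o)
  × (∀ t → Adj (c t) (c (csucc t)))

EdgeOf : ∀ {V : Set} {N : ℕ} → (Fin N → V) → V → V → Set
EdgeOf {N = N} c u v =
  ∃ λ (t : Fin N) → (c t ≡ u × c (csucc t) ≡ v) ⊎ (c t ≡ v × c (csucc t) ≡ u)

IsHamDecomp : ∀ {V : Set} (Adj : V → V → Set) (o : V) (N : ℕ) {I : Set}
              → (I → Fin N → V) → Set
IsHamDecomp {V} Adj o N {I} C =
  (∀ i → IsDirHamCycle Adj o N (C i))
  × (∀ u v → Adj u v →
       (∃ λ i → EdgeOf (C i) u v)
       × (∀ i j → EdgeOf (C i) u v → EdgeOf (C j) u v → i ≡ j))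

-- Q_{2m} = C_4 □ ... □ C_4 (m factors): quaternary strings of length m

QV : ℕ → Set
QV m = Vec (Fin 4) m

QAdj : ∀ {m} → QV m → QV m → Set
QAdj {m} u v = ∃ λ (i : Fin m) →
  CycAdj (lookup u i) (lookup v i) × (∀ j → j ≢ i → lookup u j ≡ lookup v j)

Qorigin : ∀ m → QV m
Qorigin m = replicate m Fin.zero

-- G_{n,2} = C_{4^n} □ C_{4^n}

GV : ℕ → Set
GV n = Fin (4 ^ n) × Fin (4 ^ n)

GAdj : ∀ {n} → GV n → GV n → Set
GAdj (x , y) (x' , y') = (CycAdj x x' × y ≡ y') ⊎ (x ≡ x' × CycAdj y y')

zero4^ : ∀ n → Fin (4 ^ n)
zero4^ n = fromℕ< (m^n>0 4 n)

Gorigin : ∀ n → GV n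
Gorigin n = zero4^ n , zero4^ n

-- f(E,H): the t-th vertex of f(E,H) is (φ_E⁻¹(x_t), φ_E⁻¹(y_t)) where
-- H t = (x_t , y_t); since φ_E⁻¹ = E (E t is the t-th vertex of E),
-- this is E x_t on axes 1..n followed by E y_t on axes n+1..2n.
f : ∀ {n} → (Fin (4 ^ n) → QV n) → (Fin (4 ^ n * 4 ^ n) → GV n)
    → Fin (4 ^ n * 4 ^ n) → QV (n + n)
f E H t = E (proj₁ (H t)) ++ E (proj₂ (H t))

-- Numbering the vertices of Q_{2n} along a Hamilton cycle E makes (x , y) ↦ E x ++ E y a
-- bijection from G_{n,2} = C_{4^n} □ C_{4^n} onto Q_{4n} = Q_{2n} □ Q_{2n}, carrying the
-- edges of G_{n,2} onto those edges of Q_{4n} along which one half moves along an edge of E.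
-- An edge of Q_{4n} moves exactly one half, along an edge of Q_{2n} lying in exactly one
-- E_k, so these copies of G_{n,2} partition the edges of Q_{4n}; the images of H_1 and H_2
-- in the k-th copy are f(E_k, H_1) and f(E_k, H_2).
module Submission where

open import Defs
open import Data.Nat using (ℕ; _≤_; _^_; _*_; _+_; zero; suc)
open import Data.Fin using (Fin; _↑ˡ_; _↑ʳ_; splitAt)
open import Data.Fin.Properties
  using (toℕ-fromℕ<; splitAt-↑ˡ; splitAt-↑ʳ; splitAt⁻¹-↑ˡ; splitAt⁻¹-↑ʳ; ↑ˡ-injective; ↑ʳ-injective)
open import Data.Product using (_×_; _,_; proj₁; proj₂; ∃; ∃₂)
open import Data.Sum using (_⊎_; inj₁; inj₂)
open import Data.Empty using (⊥-elim)
open import Data.Vec using (Vec; _∷_; lookup; replicate; _++_)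
import Data.Vec as Vec
open import Data.Vec.Properties using (++-injective; lookup-++ˡ; lookup-++ʳ)
open import Data.Vec.Relation.Binary.Pointwise.Extensional using (ext; Pointwise-≡⇒≡)
open import Function.Base using (_∘_)
open import Function.Definitions using (Bijective; Injective; Surjective)
import Function.Construct.Composition as Composition
open import Relation.Nullary using (¬_)
open import Relation.Binary.PropositionalEquality

private
  variable
    K V W : Set
    m n N : ℕ

EdgeOf-∘ : {c : Fin N → V} (g : V → W) {u v : V} → EdgeOf c u v → EdgeOf (g ∘ c) (g u) (g v)
EdgeOf-∘ g (t , inj₁ (p , q)) = t , inj₁ (cong g p , cong g q)
EdgeOf-∘ g (t , inj₂ (p , q)) = t , inj₂ (cong g p , cong g q)

EdgeOf-∘⁻¹ : {c : Fin N → V} {g : V → W} → Injective _≡_ _≡_ g →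
             {u v : V} → EdgeOf (g ∘ c) (g u) (g v) → EdgeOf c u v
EdgeOf-∘⁻¹ g-inj (t , inj₁ (p , q)) = t , inj₁ (g-inj p , g-inj q)
EdgeOf-∘⁻¹ g-inj (t , inj₂ (p , q)) = t , inj₂ (g-inj p , g-inj q)

EdgeOf⇒CycAdj : {c : Fin N → V} {u v : V} → EdgeOf c u v →
                ∃₂ λ s s' → CycAdj s s' × c s ≡ u × c s' ≡ v
EdgeOf⇒CycAdj (t , inj₁ (p , q)) = t , csucc t , inj₁ refl , p , q
EdgeOf⇒CycAdj (t , inj₂ (p , q)) = csucc t , t , inj₂ refl , q , p

CycAdj⇒EdgeOf : (c : Fin N → V) {s s' : Fin N} → CycAdj s s' → EdgeOf c (c s) (c s')
CycAdj⇒EdgeOf c {s}      (inj₁ refl) = s , inj₁ (refl , refl)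
CycAdj⇒EdgeOf c {s' = s'} (inj₂ refl) = s' , inj₂ (refl , refl)

module _ {Adj : V → V → Set} {o : V} {c : Fin N → V}
         (c-ham : IsDirHamCycle Adj o N c) (Adj-sym : ∀ {x y} → Adj x y → Adj y x) where

  CycAdj⇒Adj : {s s' : Fin N} → CycAdj s s' → Adj (c s) (c s')
  CycAdj⇒Adj {s}       (inj₁ refl) = proj₂ (proj₂ c-ham) s
  CycAdj⇒Adj {s' = s'} (inj₂ refl) = Adj-sym (proj₂ (proj₂ c-ham) s')

  EdgeOf⇒Adj : {u v : V} → EdgeOf c u v → Adj u v
  EdgeOf⇒Adj e with EdgeOf⇒CycAdj e
  ... | s , s' , ss' , refl , refl = CycAdj⇒Adj ss'

IsDirHamCycle-∘ : {Adj : V → V → Set} {Adj' : W → W → Set} {o : V} {o' : W}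
                  {c : Fin N → V} {g : V → W} →
                  Bijective _≡_ _≡_ g → (∀ {p q} → Adj p q → Adj' (g p) (g q)) → g o ≡ o' →
                  IsDirHamCycle Adj o N c → IsDirHamCycle Adj' o' N (g ∘ c)
IsDirHamCycle-∘ {g = g} g-bij g-adj g-o (c-bij , c-o , c-adj) =
  Composition.bijective _≡_ _≡_ _≡_ c-bij g-bij ,
  (λ t t≡0 → trans (cong g (c-o t t≡0)) g-o) ,
  (λ t → g-adj (c-adj t))

ImageEdge : (Adj : V → V → Set) → (V → W) → W → W → Set
ImageEdge Adj g u v = ∃₂ λ p q → Adj p q × g p ≡ u × g q ≡ v

EdgeOf-∘⇒ImageEdge : {Adj : V → V → Set} {o : V} {c : Fin N → V} →
                     IsDirHamCycle Adj o N c → (∀ {x y} → Adj x y → Adj y x) → (g : V → W) →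
                     {u v : W} → EdgeOf (g ∘ c) u v → ImageEdge Adj g u v
EdgeOf-∘⇒ImageEdge {Adj = Adj} {c = c} c-ham Adj-sym g e with EdgeOf⇒CycAdj e
... | s , s' , ss' , p , q = c s , c s' , CycAdj⇒Adj {Adj = Adj} c-ham Adj-sym ss' , p , q

record IsCopyDecomposition (Adj : V → V → Set) (o : V) (Adj' : W → W → Set) (o' : W)
                           (g : K → V → W) : Set where
  field
    bijective        : ∀ k → Bijective _≡_ _≡_ (g k)
    preserves-adj    : ∀ k {p q} → Adj p q → Adj' (g k p) (g k q)
    preserves-origin : ∀ k → g k o ≡ o'
    covers           : ∀ {u v} → Adj' u v → ∃ λ k → ImageEdge Adj (g k) u v
    disjoint         : ∀ {k k' u v} → ImageEdge Adj (g k) u v → ImageEdge Adj (g k') u v → k ≡ k'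

IsHamDecomp-transport : {J : Set} {Adj : V → V → Set} {Adj' : W → W → Set} {o : V} {o' : W}
                        {g : K → V → W} {C : J → Fin N → V} →
                        (∀ {x y} → Adj x y → Adj y x) → IsCopyDecomposition Adj o Adj' o' g →
                        IsHamDecomp Adj o N C →
                        IsHamDecomp Adj' o' N {K × J} (λ i → g (proj₁ i) ∘ C (proj₂ i))
IsHamDecomp-transport {K = K} {N = N} {J = J} {Adj = Adj} {Adj' = Adj'} {o' = o'} {g = g} {C = C}
                      Adj-sym copies (C-ham , C-part) =
  ham , λ u v uv → some-copy uv , unique-copy
  where
  open IsCopyDecomposition copies

  ham : ∀ ((k , j) : K × J) → IsDirHamCycle Adj' o' N (g k ∘ C j)
  ham (k , j) =
    IsDirHamCycle-∘ {Adj' = Adj'} (bijective k) (preserves-adj k) (preserves-origin k) (C-ham j)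

  some-copy : ∀ {u v} → Adj' u v → ∃ λ ((k , j) : K × J) → EdgeOf (g k ∘ C j) u v
  some-copy uv with covers uv
  ... | k , p , q , pq , refl , refl with proj₁ (C-part p q pq)
  ... | j , e = (k , j) , EdgeOf-∘ (g k) e

  image : ∀ {k j u v} → EdgeOf (g k ∘ C j) u v → ImageEdge Adj (g k) u v
  image {k} {j} = EdgeOf-∘⇒ImageEdge (C-ham j) Adj-sym (g k)

  unique-copy : ∀ {u v} (i i' : K × J) → EdgeOf (g (proj₁ i) ∘ C (proj₂ i)) u v →
                EdgeOf (g (proj₁ i') ∘ C (proj₂ i')) u v → i ≡ i'
  unique-copy (k , j) (k' , j') e e' with disjoint (image e) (image e')
  ... | refl with image e
  ... | p , q , pq , refl , refl =
    cong (k ,_) (proj₂ (C-part p q pq) j j' (EdgeOf-∘⁻¹ g-inj e) (EdgeOf-∘⁻¹ g-inj e'))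
    where
    g-inj : Injective _≡_ _≡_ (g k)
    g-inj = proj₁ (bijective k)

CycAdj-sym : {x y : Fin N} → CycAdj x y → CycAdj y x
CycAdj-sym (inj₁ p) = inj₂ p
CycAdj-sym (inj₂ p) = inj₁ p

GAdj-sym : {p q : GV n} → GAdj {n} p q → GAdj {n} q p
GAdj-sym (inj₁ (xx' , refl)) = inj₁ (CycAdj-sym xx' , refl)
GAdj-sym (inj₂ (refl , yy')) = inj₂ (refl , CycAdj-sym yy')

QAdj-sym : {u v : QV m} → QAdj u v → QAdj v u
QAdj-sym (i , uv , rest) = i , CycAdj-sym uv , λ j j≢i → sym (rest j j≢i)

CycAdj-irrefl : (x : Fin 4) → ¬ CycAdj x x
CycAdj-irrefl Fin.zero                               (inj₁ ())
CycAdj-irrefl (Fin.suc Fin.zero)                     (inj₁ ())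
CycAdj-irrefl (Fin.suc (Fin.suc Fin.zero))           (inj₁ ())
CycAdj-irrefl (Fin.suc (Fin.suc (Fin.suc Fin.zero))) (inj₁ ())
CycAdj-irrefl Fin.zero                               (inj₂ ())
CycAdj-irrefl (Fin.suc Fin.zero)                     (inj₂ ())
CycAdj-irrefl (Fin.suc (Fin.suc Fin.zero))           (inj₂ ())
CycAdj-irrefl (Fin.suc (Fin.suc (Fin.suc Fin.zero))) (inj₂ ())

QAdj-irrefl : (u : QV m) → ¬ QAdj u u
QAdj-irrefl u (i , uu , _) = CycAdj-irrefl (lookup u i) uu

data ++-Position (m n : ℕ) : Fin (m + n) → Set where
  inLeft  : (i : Fin m) → ++-Position m n (i ↑ˡ n)
  inRight : (j : Fin n) → ++-Position m n (m ↑ʳ j)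

++-position : ∀ m {n} (i : Fin (m + n)) → ++-Position m n i
++-position m {n} i with splitAt m i in eq
... | inj₁ j = subst (++-Position m n) (splitAt⁻¹-↑ˡ eq) (inLeft j)
... | inj₂ j = subst (++-Position m n) (splitAt⁻¹-↑ʳ eq) (inRight j)

↑ˡ≢↑ʳ : ∀ m {n} (i : Fin m) (j : Fin n) → i ↑ˡ n ≢ m ↑ʳ j
↑ˡ≢↑ʳ m {n} i j eq
  with trans (sym (splitAt-↑ˡ m i n)) (trans (cong (splitAt m) eq) (splitAt-↑ʳ m n j))
... | ()

QAdj-++ˡ : {a a' : QV m} (b : QV n) → QAdj a a' → QAdj (a ++ b) (a' ++ b)
QAdj-++ˡ {m} {n} {a} {a'} b (i , aa' , rest) =
  i ↑ˡ n , subst₂ CycAdj (sym (lookup-++ˡ a b i)) (sym (lookup-++ˡ a' b i)) aa' , rest'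
  where
  rest' : ∀ j → j ≢ i ↑ˡ n → lookup (a ++ b) j ≡ lookup (a' ++ b) j
  rest' j j≢ with ++-position m j
  ... | inLeft k  = begin
    lookup (a ++ b) (k ↑ˡ n)  ≡⟨ lookup-++ˡ a b k ⟩
    lookup a k                ≡⟨ rest k (j≢ ∘ cong (_↑ˡ n)) ⟩
    lookup a' k               ≡⟨ lookup-++ˡ a' b k ⟨
    lookup (a' ++ b) (k ↑ˡ n) ∎
    where open ≡-Reasoning
  ... | inRight k = trans (lookup-++ʳ a b k) (sym (lookup-++ʳ a' b k))

QAdj-++ʳ : (a : QV m) {b b' : QV n} → QAdj b b' → QAdj (a ++ b) (a ++ b')
QAdj-++ʳ {m} {n} a {b} {b'} (i , bb' , rest) =
  m ↑ʳ i , subst₂ CycAdj (sym (lookup-++ʳ a b i)) (sym (lookup-++ʳ a b' i)) bb' , rest'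
  where
  rest' : ∀ j → j ≢ m ↑ʳ i → lookup (a ++ b) j ≡ lookup (a ++ b') j
  rest' j j≢ with ++-position m j
  ... | inLeft k  = trans (lookup-++ˡ a b k) (sym (lookup-++ˡ a b' k))
  ... | inRight k = begin
    lookup (a ++ b) (m ↑ʳ k)  ≡⟨ lookup-++ʳ a b k ⟩
    lookup b k                ≡⟨ rest k (j≢ ∘ cong (m ↑ʳ_)) ⟩
    lookup b' k               ≡⟨ lookup-++ʳ a b' k ⟨
    lookup (a ++ b') (m ↑ʳ k) ∎
    where open ≡-Reasoning

module _ (a a' : QV m) (b b' : QV n) {i : Fin (m + n)}
         (rest : ∀ j → j ≢ i → lookup (a ++ b) j ≡ lookup (a' ++ b') j) where

  agree-outsideˡ : ∀ j → j ↑ˡ n ≢ i → lookup a j ≡ lookup a' j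
  agree-outsideˡ j j≢ =
    trans (sym (lookup-++ˡ a b j)) (trans (rest (j ↑ˡ n) j≢) (lookup-++ˡ a' b' j))

  agree-outsideʳ : ∀ j → m ↑ʳ j ≢ i → lookup b j ≡ lookup b' j
  agree-outsideʳ j j≢ =
    trans (sym (lookup-++ʳ a b j)) (trans (rest (m ↑ʳ j) j≢) (lookup-++ʳ a' b' j))

QAdj-++⁻ : (a a' : QV m) (b b' : QV n) → QAdj (a ++ b) (a' ++ b') →
           (QAdj a a' × b ≡ b') ⊎ (a ≡ a' × QAdj b b')
QAdj-++⁻ {m} {n} a a' b b' (i , uv , rest) with ++-position m i
... | inLeft k =
  inj₁ ( (k , subst₂ CycAdj (lookup-++ˡ a b k) (lookup-++ˡ a' b' k) uv ,
          λ j j≢k → agree-outsideˡ a a' b b' rest j (j≢k ∘ ↑ˡ-injective n j k))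
       , Pointwise-≡⇒≡ (ext λ j → agree-outsideʳ a a' b b' rest j (↑ˡ≢↑ʳ m k j ∘ sym)) )
... | inRight k =
  inj₂ ( Pointwise-≡⇒≡ (ext λ j → agree-outsideˡ a a' b b' rest j (↑ˡ≢↑ʳ m j k))
       , (k , subst₂ CycAdj (lookup-++ʳ a b k) (lookup-++ʳ a' b' k) uv ,
          λ j j≢k → agree-outsideʳ a a' b b' rest j (j≢k ∘ ↑ʳ-injective m j k)) )

replicate-++ : ∀ {A : Set} (x : A) m n → replicate m x ++ replicate n x ≡ replicate (m + n) x
replicate-++ x zero    n = refl
replicate-++ x (suc m) n = cong (x ∷_) (replicate-++ x m n)

toQ : (Fin (4 ^ n) → QV n) → GV n → QV (n + n)
toQ E p = E (proj₁ p) ++ E (proj₂ p)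

ImageEdge-toQ⁻ : {E : Fin (4 ^ n) → QV n} {a a' b b' : QV n} →
                 ImageEdge (GAdj {n}) (toQ E) (a ++ b) (a' ++ b') →
                 (EdgeOf E a a' × b ≡ b') ⊎ (a ≡ a' × EdgeOf E b b')
ImageEdge-toQ⁻ {E = E} {a} {a'} ((x , _) , (x' , _) , inj₁ (xx' , refl) , eq , eq')
  with ++-injective (E x) a eq | ++-injective (E x') a' eq'
... | refl , refl | refl , refl = inj₁ (CycAdj⇒EdgeOf E xx' , refl)
ImageEdge-toQ⁻ {E = E} {a} {a'} ((x , _) , (_ , _) , inj₂ (refl , yy') , eq , eq')
  with ++-injective (E x) a eq | ++-injective (E x) a' eq'
... | refl , refl | refl , refl = inj₂ (refl , CycAdj⇒EdgeOf E yy')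

module _ {E : Fin (4 ^ n) → QV n} (E-ham : IsDirHamCycle QAdj (Qorigin n) (4 ^ n) E) where

  private
    E-inj : Injective _≡_ _≡_ E
    E-inj = proj₁ (proj₁ E-ham)

    E-surj : Surjective _≡_ _≡_ E
    E-surj = proj₂ (proj₁ E-ham)

  -- QAdj is not injective, so unification cannot infer the implicit arguments of QAdj-sym.
  CycAdj⇒QAdj : ∀ {s s'} → CycAdj s s' → QAdj (E s) (E s')
  CycAdj⇒QAdj = CycAdj⇒Adj E-ham (λ {u} {v} → QAdj-sym {u = u} {v})

  EdgeOf⇒QAdj : ∀ {a a'} → EdgeOf E a a' → QAdj a a'
  EdgeOf⇒QAdj = EdgeOf⇒Adj E-ham (λ {u} {v} → QAdj-sym {u = u} {v})

  toQ-bijective : Bijective _≡_ _≡_ (toQ E)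
  toQ-bijective = injective , surjective
    where
    injective : Injective _≡_ _≡_ (toQ E)
    injective {x , y} {x' , y'} eq with ++-injective (E x) (E x') eq
    ... | Ex≡Ex' , Ey≡Ey' = cong₂ _,_ (E-inj Ex≡Ex') (E-inj Ey≡Ey')

    surjective : Surjective _≡_ _≡_ (toQ E)
    surjective u with Vec.splitAt n u
    ... | a , b , refl with E-surj a | E-surj b
    ... | x , Ex≡a | y , Ey≡b = (x , y) , λ { refl → cong₂ _++_ (Ex≡a refl) (Ey≡b refl) }

  toQ-origin : toQ E (Gorigin n) ≡ Qorigin (n + n)
  toQ-origin = begin
    E (zero4^ n) ++ E (zero4^ n) ≡⟨ cong₂ _++_ E-origin E-origin ⟩
    Qorigin n ++ Qorigin n       ≡⟨ replicate-++ Fin.zero n n ⟩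
    Qorigin (n + n)              ∎
    where
    open ≡-Reasoning
    E-origin : E (zero4^ n) ≡ Qorigin n
    E-origin = proj₁ (proj₂ E-ham) (zero4^ n) (toℕ-fromℕ< _)

  toQ-adj : ∀ {p q} → GAdj {n} p q → QAdj (toQ E p) (toQ E q)
  toQ-adj {x , y} {x' , _} (inj₁ (xx' , refl)) =
    QAdj-++ˡ {a = E x} {a' = E x'} (E y) (CycAdj⇒QAdj xx')
  toQ-adj {x , _} {_ , _}  (inj₂ (refl , yy')) = QAdj-++ʳ (E x) (CycAdj⇒QAdj yy')

  EdgeOf⇒ImageEdge-toQˡ : ∀ {a a'} (b : QV n) → EdgeOf E a a' →
                          ImageEdge (GAdj {n}) (toQ E) (a ++ b) (a' ++ b)
  EdgeOf⇒ImageEdge-toQˡ b e with EdgeOf⇒CycAdj e | E-surj b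
  ... | s , s' , ss' , refl , refl | y , Ey≡b =
    (s , y) , (s' , y) , inj₁ (ss' , refl) ,
    cong (E s ++_) (Ey≡b refl) , cong (E s' ++_) (Ey≡b refl)

  EdgeOf⇒ImageEdge-toQʳ : ∀ (a : QV n) {b b'} → EdgeOf E b b' →
                          ImageEdge (GAdj {n}) (toQ E) (a ++ b) (a ++ b')
  EdgeOf⇒ImageEdge-toQʳ a e with EdgeOf⇒CycAdj e | E-surj a
  ... | s , s' , ss' , refl , refl | x , Ex≡a =
    (x , s) , (x , s') , inj₂ (refl , ss') ,
    cong (_++ E s) (Ex≡a refl) , cong (_++ E s') (Ex≡a refl)

toQ-copyDecomposition : {E : K → Fin (4 ^ n) → QV n} → IsHamDecomp QAdj (Qorigin n) (4 ^ n) E →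
                        IsCopyDecomposition (GAdj {n}) (Gorigin n) QAdj (Qorigin (n + n))
                                            (λ k → toQ (E k))
toQ-copyDecomposition {n = n} {E = E} (E-ham , E-part) = record
  { bijective        = λ k → toQ-bijective (E-ham k)
  ; preserves-adj    = λ k → toQ-adj (E-ham k)
  ; preserves-origin = λ k → toQ-origin (E-ham k)
  ; covers           = covers
  ; disjoint         = disjoint
  }
  where
  covers : ∀ {u v} → QAdj u v → ∃ λ k → ImageEdge (GAdj {n}) (toQ (E k)) u v
  covers {u} {v} uv with Vec.splitAt n u | Vec.splitAt n v
  ... | a , b , refl | a' , b' , refl with QAdj-++⁻ a a' b b' uv
  ... | inj₁ (aa' , refl) = let k , e = proj₁ (E-part a a' aa')
                            in k , EdgeOf⇒ImageEdge-toQˡ (E-ham k) b e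
  ... | inj₂ (refl , bb') = let k , e = proj₁ (E-part b b' bb')
                            in k , EdgeOf⇒ImageEdge-toQʳ (E-ham k) a e

  disjoint : ∀ {k k' u v} → ImageEdge (GAdj {n}) (toQ (E k)) u v →
             ImageEdge (GAdj {n}) (toQ (E k')) u v → k ≡ k'
  disjoint {k} {k'} {u} {v} im im' with Vec.splitAt n u | Vec.splitAt n v
  ... | a , b , refl | a' , b' , refl with ImageEdge-toQ⁻ im | ImageEdge-toQ⁻ im'
  ... | inj₁ (e , _)    | inj₁ (e' , _)   = proj₂ (E-part a a' (EdgeOf⇒QAdj (E-ham k) e)) k k' e e'
  ... | inj₂ (_ , e)    | inj₂ (_ , e')   = proj₂ (E-part b b' (EdgeOf⇒QAdj (E-ham k) e)) k k' e e'
  ... | inj₁ (e , _)    | inj₂ (refl , _) = ⊥-elim (QAdj-irrefl a (EdgeOf⇒QAdj (E-ham k) e))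
  ... | inj₂ (refl , _) | inj₁ (e' , _)   = ⊥-elim (QAdj-irrefl a (EdgeOf⇒QAdj (E-ham k') e'))

corollary1 : (n : ℕ) → 1 ≤ n
    → (H : Fin 2 → Fin (4 ^ n * 4 ^ n) → GV n)
    → IsHamDecomp (GAdj {n}) (Gorigin n) (4 ^ n * 4 ^ n) H
    → (E : Fin n → Fin (4 ^ n) → QV n)
    → IsHamDecomp (QAdj {n}) (Qorigin n) (4 ^ n) E
    → IsHamDecomp (QAdj {n + n}) (Qorigin (n + n)) (4 ^ n * 4 ^ n)
    {Fin n × Fin 2} (λ p → f (E (proj₁ p)) (H (proj₂ p)))
corollary1 n _ H H-decomp E E-decomp =
  IsHamDecomp-transport (GAdj-sym {n = n}) (toQ-copyDecomposition E-decomp) H-decomp
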